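{- Let $t_*$ and $t_*'$ be well-typed t-closed t-terms and $u_*$ a well-typed t-closed e-term of the ptq-calculus. Then (1) $\lfloor t_*\cdot t_*'\rfloor=\lfloor t_*\rfloor\cdot\lfloor t_*'\rfloor$ and (2) $\lfloor t_*\cdot u_*\rfloor=\lfloor t_*\rfloor\cdot\lfloor u_*\rfloor$.
   Context: The ptq-calculus. Terms: p-variables $x,y,\dots$; a t-variable $k$; a constant $*$. p-terms $p::=x\mid\lambda\langle x,k\rangle.u\mid\lambda k.u$; t-terms $t::=*\mid k\mid\langle p,t\rangle\mid\lambda x.u$; q-terms $q::=\overline{\lambda}k.u$; e-terms $u::=t;p\mid q\,t$. $\lambda\langle x,k\rangle$ binds $x,k$; $\lambda k,\overline\lambda k$ bind $k$; $\lambda x$ binds $x$; terms modulo $\alpha$-conversion. A term is t-closed if it has no free t-variable; for $u$ with $k$ free, $u_*:=u[*/k]$. Well-typedness refers to the ptq type system (types $A^{\mathsf p},A^{\mathsf t},A^{\mathsf q}$ over implicational types $A$; in a well-typed t-closed t-term or e-term the constant $*$ occurs exactly once, not under a binder of $k$). Composition: for t-closed t-terms $t_*$ and t-closed t-/e-terms $a_*$, $t_*\cdot a_*:=a_*[t_*/*]$. $\Lambda_\Box$-terms: $\lambda$-terms over the p-variables that may contain a constant $\Box$ (hole); $M\cdot N:=M[N/\Box]$ (capture-avoiding substitution). Readback: $\lfloor *\rfloor=\Box$; $\lfloor x\rfloor=x$; $\lfloor\langle p,t_*\rangle\rfloor=\lfloor t_*\rfloor\cdot(\Box\,\lfloor p\rfloor)$;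 $\lfloor\lambda\langle x,k\rangle.u\rfloor=\lambda x.\lfloor u_*\rfloor$; $\lfloor\lambda x.u_*\rfloor=\lfloor u_*\rfloor[\Box/x]$; $\lfloor\lambda k.u\rfloor=\lfloor u_*\rfloor$; $\lfloor\overline\lambda k.u\rfloor=\lfloor u_*\rfloor$; $\lfloor t_*;p\rfloor=\lfloor t_*\rfloor\cdot\lfloor p\rfloor$; $\lfloor q\,t_*\rfloor=\lfloor t_*\rfloor\cdot\lfloor q\rfloor$. -}

module Defs where

open import Data.Nat using (ℕ; zero; suc; _+_)
open import Data.Fin using (Fin; zero; suc)
open import Data.Bool using (Bool; true; false)
open import Data.Product using (_×_)
open import Relation.Binary.PropositionalEquality using (_≡_; refl; cong; cong₂)

-- ptq-terms, well-scoped de Bruijn representation (terms modulo α).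
-- n   = number of p-variables in scope (de Bruijn, Fin n);
-- the single t-variable k is in scope iff the Bool index is true
-- (each binder of k rebinds it).  p-terms and q-terms bind k at their
-- root (or are variables), hence never contain a free k.
-- t-closed t-/e-terms are exactly those of index false.

mutual
  data PTm (n : ℕ) : Set where
    pvar   : Fin n → PTm n
    plamxk : ETm (suc n) true → PTm n      -- λ⟨x,k⟩.u
    plamk  : ETm n true → PTm n            -- λk.u

  data TTm (n : ℕ) : Bool → Set where
    star  : ∀ {b} → TTm n b
    kvar  : TTm n true
    tpair : ∀ {b} → PTm n → TTm n b → TTm n b
    tlamx : ∀ {b} → ETm (suc n) b → TTm n b

  data QTm (n : ℕ) : Set where
    qlamk : ETm n true → QTm n             -- λ̄k.u

  data ETm (n : ℕ) : Bool → Set where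
    cut  : ∀ {b} → TTm n b → PTm n → ETm n b     -- t;p
    qapp : ∀ {b} → QTm n → TTm n b → ETm n b

ext : ∀ {m n} → (Fin m → Fin n) → Fin (suc m) → Fin (suc n)
ext ρ zero    = zero
ext ρ (suc i) = suc (ρ i)

mutual
  renP : ∀ {m n} → (Fin m → Fin n) → PTm m → PTm n
  renP ρ (pvar x)   = pvar (ρ x)
  renP ρ (plamxk u) = plamxk (renE (ext ρ) u)
  renP ρ (plamk u)  = plamk (renE ρ u)

  renT : ∀ {m n b} → (Fin m → Fin n) → TTm m b → TTm n b
  renT ρ star        = star
  renT ρ kvar        = kvar
  renT ρ (tpair p t) = tpair (renP ρ p) (renT ρ t)
  renT ρ (tlamx u)   = tlamx (renE (ext ρ) u)

  renQ : ∀ {m n} → (Fin m → Fin n) → QTm m → QTm n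
  renQ ρ (qlamk u) = qlamk (renE ρ u)

  renE : ∀ {m n b} → (Fin m → Fin n) → ETm m b → ETm n b
  renE ρ (cut t p)  = cut (renT ρ t) (renP ρ p)
  renE ρ (qapp q t) = qapp (renQ ρ q) (renT ρ t)

mutual
  embT : ∀ {n b} → TTm n false → TTm n b
  embT star        = star
  embT (tpair p t) = tpair p (embT t)
  embT (tlamx u)   = tlamx (embE u)

  embE : ∀ {n b} → ETm n false → ETm n b
  embE (cut t p)  = cut (embT t) p
  embE (qapp q t) = qapp q (embT t)

-- u_* := u[*/k]  (instantiation of the free t-variable by *)

mutual
  instT : ∀ {n} → TTm n true → TTm n false
  instT star        = star
  instT kvar        = star
  instT (tpair p t) = tpair p (instT t)
  instT (tlamx u)   = tlamx (instE u)

  instE : ∀ {n} → ETm n true → ETm n false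
  instE (cut t p)  = cut (instT t) p
  instE (qapp q t) = qapp q (instT t)

mutual
  sstP : ∀ {n} → TTm n false → PTm n → PTm n
  sstP s (pvar x)   = pvar x
  sstP s (plamxk u) = plamxk (sstE (renT suc s) u)
  sstP s (plamk u)  = plamk (sstE s u)

  sstT : ∀ {n b} → TTm n false → TTm n b → TTm n b
  sstT s star        = embT s
  sstT s kvar        = kvar
  sstT s (tpair p t) = tpair (sstP s p) (sstT s t)
  sstT s (tlamx u)   = tlamx (sstE (renT suc s) u)

  sstQ : ∀ {n} → TTm n false → QTm n → QTm n
  sstQ s (qlamk u) = qlamk (sstE s u)

  sstE : ∀ {n b} → TTm n false → ETm n b → ETm n b
  sstE s (cut t p)  = cut (sstT s t) (sstP s p)
  sstE s (qapp q t) = qapp (sstQ s q) (sstT s t)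

-- composition  t_* · a_* := a_*[t_*/*]
_∙T_ : ∀ {n} → TTm n false → TTm n false → TTm n false
t ∙T t' = sstT t t'

_∙E_ : ∀ {n} → TTm n false → ETm n false → ETm n false
t ∙E u = sstE t u

data Lam (n : ℕ) : Set where
  lvar : Fin n → Lam n
  llam : Lam (suc n) → Lam n
  lapp : Lam n → Lam n → Lam n
  hole : Lam n

renL : ∀ {m n} → (Fin m → Fin n) → Lam m → Lam n
renL ρ (lvar x)   = lvar (ρ x)
renL ρ (llam M)   = llam (renL (ext ρ) M)
renL ρ (lapp M N) = lapp (renL ρ M) (renL ρ N)
renL ρ hole       = hole

extsL : ∀ {m n} → (Fin m → Lam n) → Fin (suc m) → Lam (suc n)
extsL σ zero    = lvar zero
extsL σ (suc i) = renL suc (σ i)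

subL : ∀ {m n} → (Fin m → Lam n) → Lam m → Lam n
subL σ (lvar x)   = σ x
subL σ (llam M)   = llam (subL (extsL σ) M)
subL σ (lapp M N) = lapp (subL σ M) (subL σ N)
subL σ hole       = hole

-- M · N := M[N/□]  (capture-avoiding)
infixl 5 _·_
_·_ : ∀ {n} → Lam n → Lam n → Lam n
lvar x   · N = lvar x
llam M   · N = llam (M · renL suc N)
lapp M P · N = lapp (M · N) (P · N)
hole     · N = N

holeFor0 : ∀ {n} → Fin (suc n) → Lam n
holeFor0 zero    = hole
holeFor0 (suc i) = lvar i

_[□/0] : ∀ {n} → Lam (suc n) → Lam n
M [□/0] = subL holeFor0 M

-- To keep the definition structurally recursive, it is
-- defined on terms possibly containing the free t-variable k by reading
-- k as □; then ⌊u_*⌋ = ⌊u[*/k]⌋ coincides with rb u (lemmas below), so the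
-- paper's clauses ⌊λ⟨x,k⟩.u⌋ = λx.⌊u_*⌋, ⌊λk.u⌋ = ⌊u_*⌋, ⌊λ̄k.u⌋ = ⌊u_*⌋ hold.

mutual
  rbP : ∀ {n} → PTm n → Lam n
  rbP (pvar x)   = lvar x
  rbP (plamxk u) = llam (rbE u)
  rbP (plamk u)  = rbE u

  rbT : ∀ {n b} → TTm n b → Lam n
  rbT star        = hole
  rbT kvar        = hole
  rbT (tpair p t) = rbT t · lapp hole (rbP p)
  rbT (tlamx u)   = rbE u [□/0]

  rbQ : ∀ {n} → QTm n → Lam n
  rbQ (qlamk u) = rbE u

  rbE : ∀ {n b} → ETm n b → Lam n
  rbE (cut t p)  = rbT t · rbP p
  rbE (qapp q t) = rbT t · rbQ q

mutual
  rb-instT : ∀ {n} (t : TTm n true) → rbT (instT t) ≡ rbT t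
  rb-instT star        = refl
  rb-instT kvar        = refl
  rb-instT (tpair p t) = cong (λ M → M · lapp hole (rbP p)) (rb-instT t)
  rb-instT (tlamx u)   = cong _[□/0] (rb-instE u)

  rb-instE : ∀ {n} (u : ETm n true) → rbE (instE u) ≡ rbE u
  rb-instE (cut t p)  = cong (_· rbP p) (rb-instT t)
  rb-instE (qapp q t) = cong (_· rbQ q) (rb-instT t)

⌊_⌋T : ∀ {n} → TTm n false → Lam n
⌊ t ⌋T = rbT t

⌊_⌋E : ∀ {n} → ETm n false → Lam n
⌊ u ⌋E = rbE u

mutual
  starsP : ∀ {n} → PTm n → ℕ
  starsP (pvar x)   = 0
  starsP (plamxk u) = starsE u
  starsP (plamk u)  = starsE u

  starsT : ∀ {n b} → TTm n b → ℕ
  starsT star        = 1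
  starsT kvar        = 0
  starsT (tpair p t) = starsP p + starsT t
  starsT (tlamx u)   = starsE u

  starsQ : ∀ {n} → QTm n → ℕ
  starsQ (qlamk u) = starsE u

  starsE : ∀ {n b} → ETm n b → ℕ
  starsE (cut t p)  = starsT t + starsP p
  starsE (qapp q t) = starsQ q + starsT t

-- p- and q-terms have a k-binder at their root, so every * inside them
-- is under a binder of k.
mutual
  freeStarsT : ∀ {n b} → TTm n b → ℕ
  freeStarsT star        = 1
  freeStarsT kvar        = 0
  freeStarsT (tpair p t) = freeStarsT t
  freeStarsT (tlamx u)   = freeStarsE u

  freeStarsE : ∀ {n b} → ETm n b → ℕ
  freeStarsE (cut t p)  = freeStarsT t
  freeStarsE (qapp q t) = freeStarsT t

StarOnceT : ∀ {n} → TTm n false → Set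
StarOnceT t = (starsT t ≡ 1) × (freeStarsT t ≡ 1)

StarOnceE : ∀ {n} → ETm n false → Set
StarOnceE u = (starsE u ≡ 1) × (freeStarsE u ≡ 1)

-- The unique occurrence of * lies on the spine of the term, i.e. outside
-- every p- and q-term, so the side p- and q-terms are *-free and t · a only
-- rewrites the spine.  The readback of a spine is a left-nested plugging
-- ⌊t⌋ · …, so the claim comes down to associativity of _·_.  At a binder
-- λx.u the plugged term is a weakening, hence free of x, and turning x into
-- □ commutes with plugging it.
module Submission where

open import Defs
open import Data.Nat using (ℕ; zero; suc; _+_; _≤_; _<_; z≤n; s≤s)
open import Data.Nat.Properties using (≤-trans; m≤m+n; m≤n+m; m+n≡0⇒m≡0; m+n≡0⇒n≡0; suc-injective; +-comm)
open import Data.Fin using (Fin; zero; suc)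
open import Data.Bool using (false)
open import Data.Product using (_×_; _,_)
open import Function using (id; _∘_)
open import Relation.Binary.PropositionalEquality
open ≡-Reasoning

renL-cong : ∀ {m n} {ρ ρ′ : Fin m → Fin n} → (∀ i → ρ i ≡ ρ′ i) → ∀ M → renL ρ M ≡ renL ρ′ M
renL-cong e (lvar x)   = cong lvar (e x)
renL-cong e (llam M)   = cong llam (renL-cong ext-cong M)
  where ext-cong : ∀ i → ext _ i ≡ ext _ i
        ext-cong zero    = refl
        ext-cong (suc i) = cong suc (e i)
renL-cong e (lapp M N) = cong₂ lapp (renL-cong e M) (renL-cong e N)
renL-cong e hole       = refl

subL-cong : ∀ {m n} {σ τ : Fin m → Lam n} → (∀ i → σ i ≡ τ i) → ∀ M → subL σ M ≡ subL τ M
subL-cong e (lvar x)   = e x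
subL-cong e (llam M)   = cong llam (subL-cong extsL-cong M)
  where extsL-cong : ∀ i → extsL _ i ≡ extsL _ i
        extsL-cong zero    = refl
        extsL-cong (suc i) = cong (renL suc) (e i)
subL-cong e (lapp M N) = cong₂ lapp (subL-cong e M) (subL-cong e N)
subL-cong e hole       = refl

ext-∘ : ∀ {m n p} (ρ : Fin n → Fin p) (ρ′ : Fin m → Fin n) i → ext ρ (ext ρ′ i) ≡ ext (ρ ∘ ρ′) i
ext-∘ ρ ρ′ zero    = refl
ext-∘ ρ ρ′ (suc i) = refl

renL-∘ : ∀ {m n p} (ρ : Fin n → Fin p) (ρ′ : Fin m → Fin n) M → renL ρ (renL ρ′ M) ≡ renL (ρ ∘ ρ′) M
renL-∘ ρ ρ′ (lvar x)   = refl
renL-∘ ρ ρ′ (llam M)   = cong llam (trans (renL-∘ (ext ρ) (ext ρ′) M) (renL-cong (ext-∘ ρ ρ′) M))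
renL-∘ ρ ρ′ (lapp M N) = cong₂ lapp (renL-∘ ρ ρ′ M) (renL-∘ ρ ρ′ N)
renL-∘ ρ ρ′ hole       = refl

renL-id : ∀ {n} (M : Lam n) → renL id M ≡ M
renL-id (lvar x)   = refl
renL-id (llam M)   = cong llam (trans (renL-cong ext-id M) (renL-id M))
  where ext-id : ∀ i → ext id i ≡ i
        ext-id zero    = refl
        ext-id (suc i) = refl
renL-id (lapp M N) = cong₂ lapp (renL-id M) (renL-id N)
renL-id hole       = refl

subL-renL : ∀ {m n p} (σ : Fin n → Lam p) (ρ : Fin m → Fin n) M → subL σ (renL ρ M) ≡ subL (σ ∘ ρ) M
subL-renL σ ρ (lvar x)   = refl
subL-renL σ ρ (llam M)   = cong llam (trans (subL-renL (extsL σ) (ext ρ) M) (subL-cong extsL-ext M))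
  where extsL-ext : ∀ i → extsL σ (ext ρ i) ≡ extsL (σ ∘ ρ) i
        extsL-ext zero    = refl
        extsL-ext (suc i) = refl
subL-renL σ ρ (lapp M N) = cong₂ lapp (subL-renL σ ρ M) (subL-renL σ ρ N)
subL-renL σ ρ hole       = refl

renL-subL : ∀ {m n p} (ρ : Fin n → Fin p) (σ : Fin m → Lam n) M → renL ρ (subL σ M) ≡ subL (renL ρ ∘ σ) M
renL-subL ρ σ (lvar x)   = refl
renL-subL ρ σ (llam M)   = cong llam (trans (renL-subL (ext ρ) (extsL σ) M) (subL-cong ext-extsL M))
  where ext-extsL : ∀ i → renL (ext ρ) (extsL σ i) ≡ extsL (renL ρ ∘ σ) i
        ext-extsL zero    = refl
        ext-extsL (suc i) = trans (renL-∘ (ext ρ) suc (σ i)) (sym (renL-∘ suc ρ (σ i)))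
renL-subL ρ σ (lapp M N) = cong₂ lapp (renL-subL ρ σ M) (renL-subL ρ σ N)
renL-subL ρ σ hole       = refl

renL-· : ∀ {m n} (ρ : Fin m → Fin n) M N → renL ρ (M · N) ≡ renL ρ M · renL ρ N
renL-· ρ (lvar x)   N = refl
renL-· ρ (llam M)   N = cong llam (trans (renL-· (ext ρ) M (renL suc N))
  (cong (renL (ext ρ) M ·_) (trans (renL-∘ (ext ρ) suc N) (sym (renL-∘ suc ρ N)))))
renL-· ρ (lapp M P) N = cong₂ lapp (renL-· ρ M N) (renL-· ρ P N)
renL-· ρ hole       N = refl

·-assoc : ∀ {n} (L M N : Lam n) → (L · M) · N ≡ L · (M · N)
·-assoc (lvar x)   M N = refl
·-assoc (llam L)   M N = cong llam (trans (·-assoc L (renL suc M) (renL suc N))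
  (cong (L ·_) (sym (renL-· suc M N))))
·-assoc (lapp L P) M N = cong₂ lapp (·-assoc L M N) (·-assoc P M N)
·-assoc hole       M N = refl

·-identityʳ : ∀ {n} (M : Lam n) → M · hole ≡ M
·-identityʳ (lvar x)   = refl
·-identityʳ (llam M)   = cong llam (·-identityʳ M)
·-identityʳ (lapp M N) = cong₂ lapp (·-identityʳ M) (·-identityʳ N)
·-identityʳ hole       = refl

-- σ may send variables to □ (as holeFor0 does), so it commutes with
-- plugging only on a term whose variables σ maps to variables.
subL-renL-· : ∀ {m p n} (σ : Fin p → Lam n) (ρ : Fin m → Fin p) (ρ′ : Fin m → Fin n)
  → (∀ i → σ (ρ i) ≡ lvar (ρ′ i)) → ∀ M N → subL σ (renL ρ M · N) ≡ renL ρ′ M · subL σ N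
subL-renL-· σ ρ ρ′ e (lvar x)   N = e x
subL-renL-· σ ρ ρ′ e (llam M)   N = cong llam (trans
    (subL-renL-· (extsL σ) (ext ρ) (ext ρ′) extsL-ext M (renL suc N))
    (cong (renL (ext ρ′) M ·_) (trans (subL-renL (extsL σ) suc N) (sym (renL-subL suc σ N)))))
  where extsL-ext : ∀ i → extsL σ (ext ρ i) ≡ lvar (ext ρ′ i)
        extsL-ext zero    = refl
        extsL-ext (suc i) = cong (renL suc) (e i)
subL-renL-· σ ρ ρ′ e (lapp M P) N = cong₂ lapp (subL-renL-· σ ρ ρ′ e M N) (subL-renL-· σ ρ ρ′ e P N)
subL-renL-· σ ρ ρ′ e hole       N = refl

[□/0]-weaken-· : ∀ {n} (M : Lam n) N → (renL suc M · N) [□/0] ≡ M · N [□/0]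
[□/0]-weaken-· M N = begin
  subL holeFor0 (renL suc M · N) ≡⟨ subL-renL-· holeFor0 suc id (λ _ → refl) M N ⟩
  renL id M · N [□/0]             ≡⟨ cong (_· N [□/0]) (renL-id M) ⟩
  M · N [□/0]                     ∎

holeFor0-ext : ∀ {m n} (ρ : Fin m → Fin n) i → holeFor0 (ext ρ i) ≡ renL ρ (holeFor0 i)
holeFor0-ext ρ zero    = refl
holeFor0-ext ρ (suc i) = refl

[□/0]-renL : ∀ {m n} (ρ : Fin m → Fin n) M → renL (ext ρ) M [□/0] ≡ renL ρ (M [□/0])
[□/0]-renL ρ M = begin
  subL holeFor0 (renL (ext ρ) M) ≡⟨ subL-renL holeFor0 (ext ρ) M ⟩
  subL (holeFor0 ∘ ext ρ) M      ≡⟨ subL-cong (holeFor0-ext ρ) M ⟩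
  subL (renL ρ ∘ holeFor0) M     ≡⟨ renL-subL ρ holeFor0 M ⟨
  renL ρ (M [□/0])               ∎

mutual
  rbP-renP : ∀ {m n} (ρ : Fin m → Fin n) p → rbP (renP ρ p) ≡ renL ρ (rbP p)
  rbP-renP ρ (pvar x)   = refl
  rbP-renP ρ (plamxk u) = cong llam (rbE-renE (ext ρ) u)
  rbP-renP ρ (plamk u)  = rbE-renE ρ u

  rbT-renT : ∀ {m n b} (ρ : Fin m → Fin n) (t : TTm m b) → rbT (renT ρ t) ≡ renL ρ (rbT t)
  rbT-renT ρ star        = refl
  rbT-renT ρ kvar        = refl
  rbT-renT ρ (tpair p t) = trans (cong₂ (λ M N → M · lapp hole N) (rbT-renT ρ t) (rbP-renP ρ p))
                                 (sym (renL-· ρ (rbT t) (lapp hole (rbP p))))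
  rbT-renT ρ (tlamx u)   = trans (cong _[□/0] (rbE-renE (ext ρ) u)) ([□/0]-renL ρ (rbE u))

  rbQ-renQ : ∀ {m n} (ρ : Fin m → Fin n) q → rbQ (renQ ρ q) ≡ renL ρ (rbQ q)
  rbQ-renQ ρ (qlamk u) = rbE-renE ρ u

  rbE-renE : ∀ {m n b} (ρ : Fin m → Fin n) (u : ETm m b) → rbE (renE ρ u) ≡ renL ρ (rbE u)
  rbE-renE ρ (cut t p)  = trans (cong₂ _·_ (rbT-renT ρ t) (rbP-renP ρ p)) (sym (renL-· ρ (rbT t) (rbP p)))
  rbE-renE ρ (qapp q t) = trans (cong₂ _·_ (rbT-renT ρ t) (rbQ-renQ ρ q)) (sym (renL-· ρ (rbT t) (rbQ q)))

mutual
  rbT-embT : ∀ {n b} (t : TTm n false) → rbT (embT {b = b} t) ≡ rbT t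
  rbT-embT star        = refl
  rbT-embT (tpair p t) = cong (_· lapp hole (rbP p)) (rbT-embT t)
  rbT-embT (tlamx u)   = cong _[□/0] (rbE-embE u)

  rbE-embE : ∀ {n b} (u : ETm n false) → rbE (embE {b = b} u) ≡ rbE u
  rbE-embE (cut t p)  = cong (_· rbP p) (rbT-embT t)
  rbE-embE (qapp q t) = cong (_· rbQ q) (rbT-embT t)

mutual
  freeStarsT≤starsT : ∀ {n b} (t : TTm n b) → freeStarsT t ≤ starsT t
  freeStarsT≤starsT star        = s≤s z≤n
  freeStarsT≤starsT kvar        = z≤n
  freeStarsT≤starsT (tpair p t) = ≤-trans (freeStarsT≤starsT t) (m≤n+m _ (starsP p))
  freeStarsT≤starsT (tlamx u)   = freeStarsE≤starsE u

  freeStarsE≤starsE : ∀ {n b} (u : ETm n b) → freeStarsE u ≤ starsE u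
  freeStarsE≤starsE (cut t p)  = ≤-trans (freeStarsT≤starsT t) (m≤m+n _ (starsP p))
  freeStarsE≤starsE (qapp q t) = ≤-trans (freeStarsT≤starsT t) (m≤n+m _ (starsQ q))

m+n≡1∧0<n⇒m≡0 : ∀ m {n} → m + n ≡ 1 → 0 < n → m ≡ 0
m+n≡1∧0<n⇒m≡0 zero    _ _ = refl
m+n≡1∧0<n⇒m≡0 (suc m) {suc n} e _ with () ← m+n≡0⇒n≡0 m (suc-injective e)

side-starless : ∀ {n b} m (t : TTm n b)
  → m + starsT t ≡ 1 → freeStarsT t ≡ 1 → (m ≡ 0) × (starsT t ≡ 1)
side-starless m t e f with m+n≡1∧0<n⇒m≡0 m e (subst (_≤ starsT t) f (freeStarsT≤starsT t))
... | refl = refl , e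

mutual
  sstP-starless : ∀ {n} (s : TTm n false) p → starsP p ≡ 0 → sstP s p ≡ p
  sstP-starless s (pvar x)   e = refl
  sstP-starless s (plamxk u) e = cong plamxk (sstE-starless (renT suc s) u e)
  sstP-starless s (plamk u)  e = cong plamk (sstE-starless s u e)

  sstT-starless : ∀ {n b} (s : TTm n false) (t : TTm n b) → starsT t ≡ 0 → sstT s t ≡ t
  sstT-starless s star        ()
  sstT-starless s kvar        e = refl
  sstT-starless s (tpair p t) e =
    cong₂ tpair (sstP-starless s p (m+n≡0⇒m≡0 _ e)) (sstT-starless s t (m+n≡0⇒n≡0 _ e))
  sstT-starless s (tlamx u)   e = cong tlamx (sstE-starless (renT suc s) u e)

  sstQ-starless : ∀ {n} (s : TTm n false) q → starsQ q ≡ 0 → sstQ s q ≡ q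
  sstQ-starless s (qlamk u) e = cong qlamk (sstE-starless s u e)

  sstE-starless : ∀ {n b} (s : TTm n false) (u : ETm n b) → starsE u ≡ 0 → sstE s u ≡ u
  sstE-starless s (cut t p)  e =
    cong₂ cut (sstT-starless s t (m+n≡0⇒m≡0 _ e)) (sstP-starless s p (m+n≡0⇒n≡0 _ e))
  sstE-starless s (qapp q t) e =
    cong₂ qapp (sstQ-starless s q (m+n≡0⇒m≡0 _ e)) (sstT-starless s t (m+n≡0⇒n≡0 _ e))

mutual
  rbT-sstT : ∀ {n b} (s : TTm n false) (t : TTm n b)
    → starsT t ≡ 1 → freeStarsT t ≡ 1 → rbT (sstT s t) ≡ rbT s · rbT t
  rbT-sstT s star _ _ = trans (rbT-embT s) (sym (·-identityʳ (rbT s)))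
  rbT-sstT s (tpair p t) e f
    with side-starless (starsP p) t e f
  ... | p-starless , t-once
    rewrite sstP-starless s p p-starless
    = begin
      rbT (sstT s t) · lapp hole (rbP p)  ≡⟨ cong (_· lapp hole (rbP p)) (rbT-sstT s t t-once f) ⟩
      (rbT s · rbT t) · lapp hole (rbP p) ≡⟨ ·-assoc (rbT s) (rbT t) _ ⟩
      rbT s · (rbT t · lapp hole (rbP p)) ∎
  rbT-sstT s (tlamx u) e f = begin
    rbE (sstE (renT suc s) u) [□/0]  ≡⟨ cong _[□/0] (rbE-sstE (renT suc s) u e f) ⟩
    (rbT (renT suc s) · rbE u) [□/0] ≡⟨ cong (λ M → (M · rbE u) [□/0]) (rbT-renT suc s) ⟩
    (renL suc (rbT s) · rbE u) [□/0] ≡⟨ [□/0]-weaken-· (rbT s) (rbE u) ⟩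
    rbT s · rbE u [□/0]              ∎

  rbE-sstE : ∀ {n b} (s : TTm n false) (u : ETm n b)
    → starsE u ≡ 1 → freeStarsE u ≡ 1 → rbE (sstE s u) ≡ rbT s · rbE u
  rbE-sstE s (cut t p) e f
    with side-starless (starsP p) t (trans (+-comm (starsP p) (starsT t)) e) f
  ... | p-starless , t-once
    rewrite sstP-starless s p p-starless
    = trans (cong (_· rbP p) (rbT-sstT s t t-once f)) (·-assoc (rbT s) (rbT t) (rbP p))
  rbE-sstE s (qapp q t) e f
    with side-starless (starsQ q) t e f
  ... | q-starless , t-once
    rewrite sstQ-starless s q q-starless
    = trans (cong (_· rbQ q) (rbT-sstT s t t-once f)) (·-assoc (rbT s) (rbT t) (rbQ q))

-- Only the argument of the composition needs its * on the spine.
lemma2 : ∀ {n : ℕ} (t t' : TTm n false) (u : ETm n false)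
         → StarOnceT t → StarOnceT t' → StarOnceE u
         → (⌊ t ∙T t' ⌋T ≡ ⌊ t ⌋T · ⌊ t' ⌋T) × (⌊ t ∙E u ⌋E ≡ ⌊ t ⌋T · ⌊ u ⌋E)
lemma2 t t' u _ (e , f) (e' , f') = rbT-sstT t t' e f , rbE-sstE t u e' f'
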